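{- Throw $A$ balls into $K$ bins, each ball independently and uniformly at random, and let $X$ be the number of nonempty bins. If $100\le A\le K/20$, then $\mathbf{Var}[X]<4A^2/K$. -}

module Defs where

open import Data.Nat using (ℕ; zero; suc; _+_; _^_)
open import Data.Nat.Properties using (m^n≢0)
open import Data.Fin using (Fin; zero; suc; _≟_)
open import Data.Fin.Properties using (any?)
open import Data.Integer using (+_)
open import Data.Rational using (ℚ; 0ℚ; _/_; _-_; _*_)
open import Data.Bool using (if_then_else_)
open import Relation.Nullary.Decidable using (⌊_⌋)

sumFin : (n : ℕ) → (Fin n → ℕ) → ℕ
sumFin zero    f = 0
sumFin (suc n) f = f zero + sumFin n (λ i → f (suc i))

consF : {K A : ℕ} → Fin K → (Fin A → Fin K) → Fin (suc A) → Fin K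
consF k h zero    = k
consF k h (suc i) = h i

sumFun : (A K : ℕ) → ((Fin A → Fin K) → ℕ) → ℕ
sumFun zero    K g = g (λ ())
sumFun (suc A) K g = sumFin K (λ k → sumFun A K (λ h → g (consF k h)))

nonempty : {A K : ℕ} → (Fin A → Fin K) → ℕ
nonempty {A} {K} f = sumFin K (λ j → if ⌊ any? (λ i → f i ≟ j) ⌋ then 1 else 0)

-- Expectation of g under the uniform distribution on assignments
-- (each ball independently uniform among the K bins).
-- For K = 0 there is no distribution (when A > 0); we return 0 (never used by the theorem).
expect : (A K : ℕ) → ((Fin A → Fin K) → ℕ) → ℚ
expect A zero    g = 0ℚ
expect A (suc K) g = (+ sumFun A (suc K) g) / (suc K ^ A)
  where instance _ = m^n≢0 (suc K) A

varNonempty : (A K : ℕ) → ℚ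
varNonempty A K =
  expect A K (λ f → nonempty f Data.Nat.* nonempty f)
  - expect A K nonempty * expect A K nonempty

-- We prove the sharper
-- bound  K · Var[X] ≤ A(A − 1)  for all A, K ≥ 2, from which the theorem
-- (Var[X] < 4A²/K) is immediate.  All probabilities are counted: with
-- N = K^A assignments, every moment is an exact natural-number sum.
--
--  * Sums over Fin and over assignments Fin A → Fin K are developed first;
--    the key fact is independence: summing a product of per-ball weights
--    over all assignments gives (Σ_k w k)^A.
--  * "Bin j is empty" is the product over balls of [ball ∉ j], so
--    Σ Y = K(K−1)^A and Σ Y² = K((K−1)^A + (K−1)(K−2)^A).
--  * Since X = K − Y, Var[X] = Var[Y]; cleared of denominators this is the
--    identity N·ΣX² + (ΣY)² = N·ΣY² + (ΣX)².
--  * Two binomial estimates, (y+1)^n ≤ y^n + n(y+1)^(n−1) and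
--    y^n + n y^(n−1) ≤ (y+1)^n, give  K·N·ΣY² ≤ A(A−1)N² + K(ΣY)².
--  * Finally the natural-number inequality is transported to ℚ.
module Submission where

open import Defs
import Data.Nat as ℕ
open import Data.Nat using (ℕ; zero; suc; _+_; _*_; _^_; _≤_; s≤s)
open import Data.Nat.Properties hiding (_≟_)
open import Data.Nat.Tactic.RingSolver using (solve-∀)
open import Data.Fin using (Fin; zero; suc; _≟_; punchIn)
open import Data.Fin.Properties using (any?; punchIn-injective; punchInᵢ≢i)
open import Data.Bool using (true; false; if_then_else_)
open import Data.Product using (_,_)
open import Data.Empty using (⊥-elim)
open import Relation.Nullary.Decidable using (⌊_⌋; yes; no)
open import Relation.Binary.PropositionalEquality
open import Data.Integer as ℤ using (ℤ; +_; +<+)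
import Data.Integer.Properties as ℤP
import Data.Integer.Tactic.RingSolver as ℤ-Ring
open import Data.Rational using (_<_; _/_; toℚᵘ)
import Data.Rational as ℚ
open import Data.Rational.Properties
  using (toℚᵘ-fromℚᵘ; toℚᵘ-homo-+; toℚᵘ-homo-*; toℚᵘ-homo‿-; toℚᵘ-cancel-<)
import Data.Rational.Unnormalised as ℚᵘ
import Data.Rational.Unnormalised.Properties as ℚᵘP

sumFin-cong : ∀ n {f g : Fin n → ℕ} → (∀ i → f i ≡ g i) → sumFin n f ≡ sumFin n g
sumFin-cong zero    e = refl
sumFin-cong (suc n) e = cong₂ _+_ (e zero) (sumFin-cong n (λ i → e (suc i)))

sumFin-+ : ∀ n (f g : Fin n → ℕ) → sumFin n (λ i → f i + g i) ≡ sumFin n f + sumFin n g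
sumFin-+ zero    f g = refl
sumFin-+ (suc n) f g
  rewrite sumFin-+ n (λ i → f (suc i)) (λ i → g (suc i)) =
  +-+-comm (f zero) (g zero) (sumFin n (λ i → f (suc i))) _
  where
  +-+-comm : ∀ a b c d → (a + b) + (c + d) ≡ (a + c) + (b + d)
  +-+-comm = solve-∀

sumFin-*ˡ : ∀ n c (f : Fin n → ℕ) → sumFin n (λ i → c * f i) ≡ c * sumFin n f
sumFin-*ˡ zero    c f = sym (*-zeroʳ c)
sumFin-*ˡ (suc n) c f
  rewrite sumFin-*ˡ n c (λ i → f (suc i)) = sym (*-distribˡ-+ c (f zero) _)

sumFin-const : ∀ n c → sumFin n (λ _ → c) ≡ n * c
sumFin-const zero    c = refl
sumFin-const (suc n) c = cong (λ t → c + t) (sumFin-const n c)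

sumFin-swap : ∀ n m (g : Fin n → Fin m → ℕ) →
  sumFin n (λ i → sumFin m (g i)) ≡ sumFin m (λ j → sumFin n (λ i → g i j))
sumFin-swap zero    m g = sym (trans (sumFin-const m 0) (*-zeroʳ m))
sumFin-swap (suc n) m g =
  trans (cong (λ t → sumFin m (g zero) + t) (sumFin-swap n m (λ i → g (suc i))))
        (sym (sumFin-+ m (g zero) (λ j → sumFin n (λ i → g (suc i) j))))

sumFin-punchIn : ∀ n (j : Fin (suc n)) (g : Fin (suc n) → ℕ) →
  sumFin (suc n) g ≡ g j + sumFin n (λ i → g (punchIn j i))
sumFin-punchIn n       zero    g = refl
sumFin-punchIn (suc n) (suc j) g
  rewrite sumFin-punchIn n j (λ i → g (suc i)) = +-exchange (g zero) (g (suc j)) _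
  where
  +-exchange : ∀ a b c → a + (b + c) ≡ b + (a + c)
  +-exchange = solve-∀

sumFin-square : ∀ n (g : Fin n → ℕ) →
  sumFin n g * sumFin n g ≡ sumFin n (λ j → sumFin n (λ l → g j * g l))
sumFin-square n g = begin
  sumFin n g * sumFin n g                       ≡⟨ sym (sumFin-*ˡ n (sumFin n g) g) ⟩
  sumFin n (λ l → sumFin n g * g l)             ≡⟨ sumFin-cong n (λ l → *-comm (sumFin n g) (g l)) ⟩
  sumFin n (λ l → g l * sumFin n g)             ≡⟨ sumFin-cong n (λ l → sym (sumFin-*ˡ n (g l) g)) ⟩
  sumFin n (λ j → sumFin n (λ l → g j * g l))   ∎
  where open ≡-Reasoning

sumFun-cong : ∀ A K {f g : (Fin A → Fin K) → ℕ} → (∀ h → f h ≡ g h) →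
  sumFun A K f ≡ sumFun A K g
sumFun-cong zero    K e = e _
sumFun-cong (suc A) K e = sumFin-cong K (λ k → sumFun-cong A K (λ h → e (consF k h)))

sumFun-+ : ∀ A K (f g : (Fin A → Fin K) → ℕ) →
  sumFun A K (λ h → f h + g h) ≡ sumFun A K f + sumFun A K g
sumFun-+ zero    K f g = refl
sumFun-+ (suc A) K f g = trans (sumFin-cong K (λ k → sumFun-+ A K _ _)) (sumFin-+ K _ _)

sumFun-*ˡ : ∀ A K c (f : (Fin A → Fin K) → ℕ) →
  sumFun A K (λ h → c * f h) ≡ c * sumFun A K f
sumFun-*ˡ zero    K c f = refl
sumFun-*ˡ (suc A) K c f = trans (sumFin-cong K (λ k → sumFun-*ˡ A K c _)) (sumFin-*ˡ K c _)

sumFun-const : ∀ A K c → sumFun A K (λ _ → c) ≡ c * K ^ A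
sumFun-const zero    K c = sym (*-identityʳ c)
sumFun-const (suc A) K c = begin
  sumFin K (λ _ → sumFun A K (λ _ → c))   ≡⟨ sumFin-cong K (λ _ → sumFun-const A K c) ⟩
  sumFin K (λ _ → c * K ^ A)              ≡⟨ sumFin-const K (c * K ^ A) ⟩
  K * (c * K ^ A)                         ≡⟨ *-commute-left K c (K ^ A) ⟩
  c * (K * K ^ A)                         ∎
  where
  open ≡-Reasoning
  *-commute-left : ∀ a b d → a * (b * d) ≡ b * (a * d)
  *-commute-left = solve-∀

sumFun-sumFin : ∀ A K m (G : (Fin A → Fin K) → Fin m → ℕ) →
  sumFun A K (λ f → sumFin m (G f)) ≡ sumFin m (λ j → sumFun A K (λ f → G f j))
sumFun-sumFin zero    K m G = refl
sumFun-sumFin (suc A) K m G =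
  trans (sumFin-cong K (λ k → sumFun-sumFin A K m (λ h → G (consF k h))))
        (sumFin-swap K m _)

ballProduct : ∀ {A K} → (Fin K → ℕ) → (Fin A → Fin K) → ℕ
ballProduct {zero}  w f = 1
ballProduct {suc A} w f = w (f zero) * ballProduct w (λ i → f (suc i))

sumFun-ballProduct : ∀ A K (w : Fin K → ℕ) → sumFun A K (ballProduct w) ≡ sumFin K w ^ A
sumFun-ballProduct zero    K w = refl
sumFun-ballProduct (suc A) K w = begin
  sumFin K (λ k → sumFun A K (λ h → w k * ballProduct w h))
    ≡⟨ sumFin-cong K (λ k → sumFun-*ˡ A K (w k) (ballProduct w)) ⟩
  sumFin K (λ k → w k * sumFun A K (ballProduct w))
    ≡⟨ sumFin-cong K (λ k → cong (w k *_) (sumFun-ballProduct A K w)) ⟩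
  sumFin K (λ k → w k * sumFin K w ^ A)
    ≡⟨ sumFin-cong K (λ k → *-comm (w k) _) ⟩
  sumFin K (λ k → sumFin K w ^ A * w k)
    ≡⟨ sumFin-*ˡ K (sumFin K w ^ A) w ⟩
  sumFin K w ^ A * sumFin K w
    ≡⟨ *-comm (sumFin K w ^ A) (sumFin K w) ⟩
  sumFin K w * sumFin K w ^ A
    ∎
  where open ≡-Reasoning

ballProduct-* : ∀ {A K} (v w : Fin K → ℕ) (f : Fin A → Fin K) →
  ballProduct v f * ballProduct w f ≡ ballProduct (λ k → v k * w k) f
ballProduct-* {zero}  v w f = refl
ballProduct-* {suc A} v w f
  rewrite sym (ballProduct-* v w (λ i → f (suc i))) =
  *-*-comm (v (f zero)) (w (f zero)) (ballProduct v (λ i → f (suc i))) _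
  where
  *-*-comm : ∀ a b c d → (a * c) * (b * d) ≡ (a * b) * (c * d)
  *-*-comm = solve-∀

ballProduct-zero : ∀ {A K} (w : Fin K → ℕ) (f : Fin A → Fin K) (i : Fin A) →
  w (f i) ≡ 0 → ballProduct w f ≡ 0
ballProduct-zero w f zero e rewrite e = refl
ballProduct-zero {suc A} w f (suc i) e
  rewrite ballProduct-zero w (λ i → f (suc i)) i e = *-zeroʳ (w (f zero))

ballProduct-one : ∀ {A K} (w : Fin K → ℕ) (f : Fin A → Fin K) →
  (∀ i → w (f i) ≡ 1) → ballProduct w f ≡ 1
ballProduct-one {zero}  w f e = refl
ballProduct-one {suc A} w f e
  rewrite e zero | ballProduct-one w (λ i → f (suc i)) (λ i → e (suc i)) = refl

avoids : ∀ {K} → Fin K → Fin K → ℕ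
avoids j k = if ⌊ k ≟ j ⌋ then 0 else 1

isEmpty : ∀ {A K} → (Fin A → Fin K) → Fin K → ℕ
isEmpty f j = if ⌊ any? (λ i → f i ≟ j) ⌋ then 0 else 1

empties : ∀ {A K} → (Fin A → Fin K) → ℕ
empties {K = K} f = sumFin K (isEmpty f)

isEmpty-ballProduct : ∀ {A K} (f : Fin A → Fin K) j → isEmpty f j ≡ ballProduct (avoids j) f
isEmpty-ballProduct f j with any? (λ i → f i ≟ j)
... | yes (i , fi≡j) = sym (ballProduct-zero (avoids j) f i avoids-hit)
  where
  avoids-hit : avoids j (f i) ≡ 0
  avoids-hit with f i ≟ j
  ... | yes _   = refl
  ... | no fi≢j = ⊥-elim (fi≢j fi≡j)
... | no none = sym (ballProduct-one (avoids j) f avoids-all)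
  where
  avoids-all : ∀ i → avoids j (f i) ≡ 1
  avoids-all i with f i ≟ j
  ... | yes fi≡j = ⊥-elim (none (i , fi≡j))
  ... | no _     = refl

nonempty+empties : ∀ {A K} (f : Fin A → Fin K) → nonempty f + empties f ≡ K
nonempty+empties {A} {K} f = begin
  nonempty f + empties f
    ≡⟨ sym (sumFin-+ K occupied (isEmpty f)) ⟩
  sumFin K (λ j → occupied j + isEmpty f j)
    ≡⟨ sumFin-cong K (λ j → complement (⌊ any? (λ i → f i ≟ j) ⌋)) ⟩
  sumFin K (λ _ → 1)
    ≡⟨ sumFin-const K 1 ⟩
  K * 1
    ≡⟨ *-identityʳ K ⟩
  K ∎
  where
  open ≡-Reasoning
  occupied : Fin K → ℕ
  occupied j = if ⌊ any? (λ i → f i ≟ j) ⌋ then 1 else 0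
  complement : ∀ b → (if b then 1 else 0) + (if b then 0 else 1) ≡ 1
  complement true  = refl
  complement false = refl

avoids-self : ∀ {K} (j : Fin K) → avoids j j ≡ 0
avoids-self j with j ≟ j
... | yes _   = refl
... | no j≢j  = ⊥-elim (j≢j refl)

avoids-punchIn : ∀ {n} (j : Fin (suc n)) i → avoids j (punchIn j i) ≡ 1
avoids-punchIn j i with punchIn j i ≟ j
... | yes e = ⊥-elim (punchInᵢ≢i j i e)
... | no _  = refl

avoids-punchIn² : ∀ {n} (j : Fin (suc n)) l i → avoids (punchIn j l) (punchIn j i) ≡ avoids l i
avoids-punchIn² j l i with i ≟ l
... | yes refl = avoids-self (punchIn j i)
... | no i≢l with punchIn j i ≟ punchIn j l
...   | yes e = ⊥-elim (i≢l (punchIn-injective j i l e))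
...   | no _  = refl

avoids-idem : ∀ {K} (j k : Fin K) → avoids j k * avoids j k ≡ avoids j k
avoids-idem j k with ⌊ k ≟ j ⌋
... | true  = refl
... | false = refl

sum-avoids : ∀ n (j : Fin (suc n)) → sumFin (suc n) (avoids j) ≡ n
sum-avoids n j = begin
  sumFin (suc n) (avoids j)
    ≡⟨ sumFin-punchIn n j (avoids j) ⟩
  avoids j j + sumFin n (λ i → avoids j (punchIn j i))
    ≡⟨ cong₂ _+_ (avoids-self j) (sumFin-cong n (avoids-punchIn j)) ⟩
  sumFin n (λ _ → 1)
    ≡⟨ sumFin-const n 1 ⟩
  n * 1
    ≡⟨ *-identityʳ n ⟩
  n ∎
  where open ≡-Reasoning

sum-avoids-pair : ∀ n (j : Fin (suc (suc n))) l →
  sumFin (suc (suc n)) (λ k → avoids j k * avoids (punchIn j l) k) ≡ n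
sum-avoids-pair n j l = begin
  sumFin (suc (suc n)) (λ k → avoids j k * avoids (punchIn j l) k)
    ≡⟨ sumFin-punchIn (suc n) j (λ k → avoids j k * avoids (punchIn j l) k) ⟩
  avoids j j * avoids (punchIn j l) j
    + sumFin (suc n) (λ i → avoids j (punchIn j i) * avoids (punchIn j l) (punchIn j i))
    ≡⟨ cong₂ _+_ (cong (_* avoids (punchIn j l) j) (avoids-self j))
                 (sumFin-cong (suc n) (λ i → cong₂ _*_ (avoids-punchIn j i) (avoids-punchIn² j l i))) ⟩
  sumFin (suc n) (λ i → 1 * avoids l i)
    ≡⟨ sumFin-cong (suc n) (λ i → *-identityˡ (avoids l i)) ⟩
  sumFin (suc n) (avoids l)
    ≡⟨ sum-avoids n l ⟩
  n ∎
  where open ≡-Reasoning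

sum-isEmpty-pair : ∀ A K (j l : Fin K) →
  sumFun A K (λ f → isEmpty f j * isEmpty f l) ≡ sumFin K (λ k → avoids j k * avoids l k) ^ A
sum-isEmpty-pair A K j l = trans
  (sumFun-cong A K (λ f → trans (cong₂ _*_ (isEmpty-ballProduct f j) (isEmpty-ballProduct f l))
                                (ballProduct-* (avoids j) (avoids l) f)))
  (sumFun-ballProduct A K _)

sum-empties : ∀ A n → sumFun A (suc n) empties ≡ suc n * n ^ A
sum-empties A n = begin
  sumFun A K empties                              ≡⟨ sumFun-sumFin A K K isEmpty ⟩
  sumFin K (λ j → sumFun A K (λ f → isEmpty f j)) ≡⟨ sumFin-cong K empty-count ⟩
  sumFin K (λ _ → n ^ A)                          ≡⟨ sumFin-const K (n ^ A) ⟩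
  K * n ^ A                                       ∎
  where
  open ≡-Reasoning
  K = suc n
  empty-count : ∀ j → sumFun A K (λ f → isEmpty f j) ≡ n ^ A
  empty-count j = begin
    sumFun A K (λ f → isEmpty f j)          ≡⟨ sumFun-cong A K (λ f → isEmpty-ballProduct f j) ⟩
    sumFun A K (ballProduct (avoids j))     ≡⟨ sumFun-ballProduct A K (avoids j) ⟩
    sumFin K (avoids j) ^ A                 ≡⟨ cong (_^ A) (sum-avoids n j) ⟩
    n ^ A                                   ∎

-- Σ_f Y(f)² = K ((K−1)^A + (K−1)(K−2)^A): split the pairs (j,l) by whether j = l.
sum-empties² : ∀ A k →
  sumFun A (suc (suc k)) (λ f → empties f * empties f) ≡ suc (suc k) * (suc k ^ A + suc k * k ^ A)
sum-empties² A k = begin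
  sumFun A K (λ f → empties f * empties f)
    ≡⟨ sumFun-cong A K (λ f → sumFin-square K (isEmpty f)) ⟩
  sumFun A K (λ f → sumFin K (λ j → sumFin K (λ l → isEmpty f j * isEmpty f l)))
    ≡⟨ sumFun-sumFin A K K (λ f j → sumFin K (λ l → isEmpty f j * isEmpty f l)) ⟩
  sumFin K (λ j → sumFun A K (λ f → sumFin K (λ l → isEmpty f j * isEmpty f l)))
    ≡⟨ sumFin-cong K pairs-with ⟩
  sumFin K (λ _ → suc k ^ A + suc k * k ^ A)
    ≡⟨ sumFin-const K (suc k ^ A + suc k * k ^ A) ⟩
  K * (suc k ^ A + suc k * k ^ A)
    ∎
  where
  open ≡-Reasoning
  K = suc (suc k)
  pairs-with : ∀ j → sumFun A K (λ f → sumFin K (λ l → isEmpty f j * isEmpty f l))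
                     ≡ suc k ^ A + suc k * k ^ A
  pairs-with j = begin
    sumFun A K (λ f → sumFin K (λ l → isEmpty f j * isEmpty f l))
      ≡⟨ sumFun-sumFin A K K (λ f l → isEmpty f j * isEmpty f l) ⟩
    sumFin K (λ l → sumFun A K (λ f → isEmpty f j * isEmpty f l))
      ≡⟨ sumFin-punchIn (suc k) j (λ l → sumFun A K (λ f → isEmpty f j * isEmpty f l)) ⟩
    sumFun A K (λ f → isEmpty f j * isEmpty f j)
      + sumFin (suc k) (λ i → sumFun A K (λ f → isEmpty f j * isEmpty f (punchIn j i)))
      ≡⟨ cong₂ _+_ same (sumFin-cong (suc k) different) ⟩
    suc k ^ A + sumFin (suc k) (λ _ → k ^ A)
      ≡⟨ cong (λ t → suc k ^ A + t) (sumFin-const (suc k) (k ^ A)) ⟩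
    suc k ^ A + suc k * k ^ A
      ∎
    where
    same : sumFun A K (λ f → isEmpty f j * isEmpty f j) ≡ suc k ^ A
    same = begin
      sumFun A K (λ f → isEmpty f j * isEmpty f j)     ≡⟨ sum-isEmpty-pair A K j j ⟩
      sumFin K (λ b → avoids j b * avoids j b) ^ A     ≡⟨ cong (_^ A) (sumFin-cong K (avoids-idem j)) ⟩
      sumFin K (avoids j) ^ A                          ≡⟨ cong (_^ A) (sum-avoids (suc k) j) ⟩
      suc k ^ A                                        ∎
    different : ∀ i → sumFun A K (λ f → isEmpty f j * isEmpty f (punchIn j i)) ≡ k ^ A
    different i = trans (sum-isEmpty-pair A K j (punchIn j i)) (cong (_^ A) (sum-avoids-pair k j i))

sum-nonempty : ∀ A K →
  sumFun A K nonempty + sumFun A K empties ≡ K * K ^ A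
sum-nonempty A K = begin
  sumFun A K nonempty + sumFun A K empties            ≡⟨ sym (sumFun-+ A K nonempty empties) ⟩
  sumFun A K (λ f → nonempty f + empties f)           ≡⟨ sumFun-cong A K nonempty+empties ⟩
  sumFun A K (λ _ → K)                                ≡⟨ sumFun-const A K K ⟩
  K * K ^ A                                           ∎
  where open ≡-Reasoning

-- (K − y)² + 2Ky = K² + y², written without subtraction.
square-complement : ∀ x y K → x + y ≡ K → x * x + 2 * K * y ≡ K * K + y * y
square-complement x y K refl = expand x y
  where
  expand : ∀ x y → x * x + 2 * (x + y) * y ≡ (x + y) * (x + y) + y * y
  expand = solve-∀

sum-nonempty² : ∀ A K →
  sumFun A K (λ f → nonempty f * nonempty f) + 2 * K * sumFun A K empties
    ≡ K * K * K ^ A + sumFun A K (λ f → empties f * empties f)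
sum-nonempty² A K = begin
  sumFun A K X² + 2 * K * sumFun A K empties
    ≡⟨ cong (λ t → sumFun A K X² + t) (sym (sumFun-*ˡ A K (2 * K) empties)) ⟩
  sumFun A K X² + sumFun A K (λ f → 2 * K * empties f)
    ≡⟨ sym (sumFun-+ A K X² _) ⟩
  sumFun A K (λ f → X² f + 2 * K * empties f)
    ≡⟨ sumFun-cong A K (λ f → square-complement (nonempty f) (empties f) K (nonempty+empties f)) ⟩
  sumFun A K (λ f → K * K + empties f * empties f)
    ≡⟨ sumFun-+ A K (λ _ → K * K) _ ⟩
  sumFun A K (λ _ → K * K) + sumFun A K (λ f → empties f * empties f)
    ≡⟨ cong (_+ sumFun A K (λ f → empties f * empties f)) (sumFun-const A K (K * K)) ⟩
  K * K * K ^ A + sumFun A K (λ f → empties f * empties f)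
    ∎
  where
  open ≡-Reasoning
  X² : (Fin A → Fin K) → ℕ
  X² f = nonempty f * nonempty f

-- Var[K − Y] = Var[Y], with denominators cleared: if s₁ + x = KN and
-- s₂ + 2Kx = K²N + z then N s₂ − s₁² = N z − x².
variance-shift : ∀ N K s₁ x s₂ z → s₁ + x ≡ K * N → s₂ + 2 * K * x ≡ K * K * N + z →
  N * s₂ + x * x ≡ N * z + s₁ * s₁
variance-shift N K s₁ x s₂ z first second = +-cancelʳ-≡ (2 * x * (K * N)) _ _ (begin
  N * s₂ + x * x + 2 * x * (K * N)    ≡⟨ regroup N K x s₂ ⟩
  N * (s₂ + 2 * K * x) + x * x        ≡⟨ cong (λ t → N * t + x * x) second ⟩
  N * (K * K * N + z) + x * x         ≡⟨ expand N K z x ⟩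
  N * z + (K * N) * (K * N) + x * x   ≡⟨ cong (λ t → N * z + t * t + x * x) (sym first) ⟩
  N * z + (s₁ + x) * (s₁ + x) + x * x ≡⟨ binomial N z s₁ x ⟩
  N * z + s₁ * s₁ + 2 * x * (s₁ + x)  ≡⟨ cong (λ t → N * z + s₁ * s₁ + 2 * x * t) first ⟩
  N * z + s₁ * s₁ + 2 * x * (K * N)   ∎)
  where
  open ≡-Reasoning
  regroup : ∀ N K x s₂ → N * s₂ + x * x + 2 * x * (K * N) ≡ N * (s₂ + 2 * K * x) + x * x
  regroup = solve-∀
  expand : ∀ N K z x → N * (K * K * N + z) + x * x ≡ N * z + (K * N) * (K * N) + x * x
  expand = solve-∀
  binomial : ∀ N z s₁ x → N * z + (s₁ + x) * (s₁ + x) + x * x ≡ N * z + s₁ * s₁ + 2 * x * (s₁ + x)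
  binomial = solve-∀

-- (y+1)^(n+1) ≤ y^(n+1) + (n+1)(y+1)^n: each of the n+1 factors may be
-- lowered from y+1 to y at the cost of one term (y+1)^n.
pow-upper : ∀ y n → suc y ^ suc n ≤ y ^ suc n + suc n * suc y ^ n
pow-upper y zero    = ≤-reflexive (base y)
  where
  base : ∀ y → (1 + y) * 1 ≡ y * 1 + 1 * 1
  base = solve-∀
pow-upper y (suc n) = begin
  suc y * (suc y * Q)                         ≤⟨ *-monoʳ-≤ (suc y) (pow-upper y n) ⟩
  suc y * (P + suc n * Q)                     ≡⟨ expand y P n Q ⟩
  y * P + P + suc n * (suc y * Q)             ≤⟨ +-monoˡ-≤ _ (+-monoʳ-≤ (y * P) (^-monoˡ-≤ (suc n) (n≤1+n y))) ⟩
  y * P + suc y * Q + suc n * (suc y * Q)     ≡⟨ collect (y * P) (suc y * Q) n ⟩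
  y * P + suc (suc n) * (suc y * Q)           ∎
  where
  open ≤-Reasoning
  P = y ^ suc n
  Q = suc y ^ n
  expand : ∀ y P n Q → (1 + y) * (P + (1 + n) * Q) ≡ y * P + P + (1 + n) * ((1 + y) * Q)
  expand = solve-∀
  collect : ∀ a R n → a + R + (1 + n) * R ≡ a + (2 + n) * R
  collect = solve-∀

-- y^(n+1) + (n+1) y^n ≤ (y+1)^(n+1): the first two terms of the binomial expansion.
pow-lower : ∀ y n → y ^ suc n + suc n * y ^ n ≤ suc y ^ suc n
pow-lower y zero    = ≤-reflexive (base y)
  where
  base : ∀ y → y * 1 + 1 * 1 ≡ (1 + y) * 1
  base = solve-∀
pow-lower y (suc n) = begin
  y * (y * Q) + suc (suc n) * (y * Q)                  ≡⟨ split y Q n ⟩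
  y * (y * Q) + y * Q + suc n * (y * Q)                ≤⟨ m≤m+n _ (suc n * Q) ⟩
  y * (y * Q) + y * Q + suc n * (y * Q) + suc n * Q    ≡⟨ factor y Q n ⟩
  suc y * (y * Q + suc n * Q)                          ≤⟨ *-monoʳ-≤ (suc y) (pow-lower y n) ⟩
  suc y * suc y ^ suc n                                ∎
  where
  open ≤-Reasoning
  Q = y ^ n
  split : ∀ y Q n → y * (y * Q) + (2 + n) * (y * Q) ≡ y * (y * Q) + y * Q + (1 + n) * (y * Q)
  split = solve-∀
  factor : ∀ y Q n → y * (y * Q) + y * Q + (1 + n) * (y * Q) + (1 + n) * Q
                     ≡ (1 + y) * (y * Q + (1 + n) * Q)
  factor = solve-∀

^-distribʳ-* : ∀ x y n → (x * y) ^ n ≡ x ^ n * y ^ n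
^-distribʳ-* x y zero    = refl
^-distribʳ-* x y (suc n) = begin
  x * y * (x * y) ^ n      ≡⟨ cong (x * y *_) (^-distribʳ-* x y n) ⟩
  x * y * (x ^ n * y ^ n)  ≡⟨ interchange x y (x ^ n) (y ^ n) ⟩
  x * x ^ n * (y * y ^ n)  ∎
  where
  open ≡-Reasoning
  interchange : ∀ a b c d → a * b * (c * d) ≡ a * c * (b * d)
  interchange = solve-∀

-- K · Var[Y] ≤ A(A − 1) for K = k+2 bins and A = m+2 balls, with the
-- moments ΣY = K a and ΣY² = K(a + (K−1) b) written out and denominators
-- N = K^A cleared.
empties-variance-bound : ∀ k m →
  let K = suc (suc k); A = suc (suc m); N = K ^ A; a = suc k ^ A; b = k ^ A in
  K * N * (K * (a + suc k * b)) ≤ A * suc m * N * N + K * (K * a * (K * a))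
empties-variance-bound k m = begin
  K * N * (K * (a + c * b))
    ≤⟨ *-monoʳ-≤ (K * N) (*-monoʳ-≤ K (+-monoˡ-≤ (c * b) top-ball)) ⟩
  K * N * (K * (b + A * c′ + c * b))
    ≡⟨ regroup-top k N b A c′ ⟩
  K * K * K * N * b + K * K * N * A * c′
    ≤⟨ +-monoʳ-≤ (K * K * K * N * b) (*-monoʳ-≤ (K * K * N * A) next-ball) ⟩
  K * K * K * N * b + K * K * N * A * (b′ + suc m * P)
    ≡⟨ regroup-next K P b b′ m ⟩
  A * suc m * N * N + K * K * K * (N * b + A * (K * P * b′))
    ≤⟨ +-monoʳ-≤ (A * suc m * N * N) (*-monoʳ-≤ (K * K * K) squared) ⟩
  A * suc m * N * N + K * K * K * (a * a)
    ≡⟨ regroup-square K a (A * suc m * N * N) ⟩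
  A * suc m * N * N + K * (K * a * (K * a))
    ∎
  where
  open ≤-Reasoning
  K = suc (suc k); c = suc k; A = suc (suc m); N = K ^ A; a = c ^ A; b = k ^ A
  P = K ^ m; b′ = k ^ suc m; c′ = c ^ suc m
  top-ball : a ≤ b + A * c′
  top-ball = pow-upper k (suc m)
  next-ball : c′ ≤ b′ + suc m * P
  next-ball = ≤-trans (pow-upper k m) (+-monoʳ-≤ b′ (*-monoʳ-≤ (suc m) (^-monoˡ-≤ m (n≤1+n c))))
  -- (Kk)^A + A (Kk)^(A−1) ≤ (Kk + 1)^A = (k+1)^(2A)
  squared : N * b + A * (K * P * b′) ≤ a * a
  squared = begin
    N * b + A * (K * P * b′)          ≡⟨ sym (cong₂ (λ u v → u + A * v) (^-distribʳ-* K k A) (^-distribʳ-* K k (suc m))) ⟩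
    (K * k) ^ A + A * (K * k) ^ suc m ≤⟨ pow-lower (K * k) (suc m) ⟩
    suc (K * k) ^ A                   ≡⟨ cong (_^ A) (square-of-succ k) ⟩
    (c * c) ^ A                       ≡⟨ ^-distribʳ-* c c A ⟩
    a * a                             ∎
    where
    square-of-succ : ∀ k → 1 + (2 + k) * k ≡ (1 + k) * (1 + k)
    square-of-succ = solve-∀
  regroup-top : ∀ k N b A c′ → (2 + k) * N * ((2 + k) * (b + A * c′ + (1 + k) * b))
                ≡ (2 + k) * (2 + k) * (2 + k) * N * b + (2 + k) * (2 + k) * N * A * c′
  regroup-top = solve-∀
  regroup-next : ∀ K P b b′ m →
    K * K * K * (K * (K * P)) * b + K * K * (K * (K * P)) * (2 + m) * (b′ + (1 + m) * P)
    ≡ (2 + m) * (1 + m) * (K * (K * P)) * (K * (K * P)) + K * K * K * (K * (K * P) * b + (2 + m) * (K * P * b′))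
  regroup-next = solve-∀
  regroup-square : ∀ K a W → W + K * K * K * (a * a) ≡ W + K * (K * a * (K * a))
  regroup-square = solve-∀

nonempty-variance-bound : ∀ k m →
  let K = suc (suc k); A = suc (suc m); N = K ^ A
      s₁ = sumFun A K nonempty; s₂ = sumFun A K (λ f → nonempty f * nonempty f) in
  K * s₂ * N ≤ A * suc m * N * N + K * s₁ * s₁
nonempty-variance-bound k m = +-cancelʳ-≤ (K * (x * x)) _ _ (begin
  K * s₂ * N + K * (x * x)             ≡⟨ factor-K K s₂ N x ⟩
  K * (N * s₂ + x * x)                 ≡⟨ cong (K *_) shift ⟩
  K * (N * z + s₁ * s₁)                ≡⟨ *-distribˡ-+ K (N * z) (s₁ * s₁) ⟩
  K * (N * z) + K * (s₁ * s₁)          ≡⟨ cong₂ _+_ (sym (*-assoc K N z)) refl ⟩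
  K * N * z + K * (s₁ * s₁)            ≤⟨ +-monoˡ-≤ (K * (s₁ * s₁)) bound ⟩
  W + K * (x * x) + K * (s₁ * s₁)      ≡⟨ swap-last W (K * (x * x)) K s₁ ⟩
  W + K * s₁ * s₁ + K * (x * x)        ∎)
  where
  open ≤-Reasoning
  K = suc (suc k); A = suc (suc m); N = K ^ A; W = A * suc m * N * N
  s₁ = sumFun A K nonempty
  s₂ = sumFun A K (λ f → nonempty f * nonempty f)
  x = sumFun A K empties
  z = sumFun A K (λ f → empties f * empties f)
  shift : N * s₂ + x * x ≡ N * z + s₁ * s₁
  shift = variance-shift N K s₁ x s₂ z (sum-nonempty A K) (sum-nonempty² A K)
  bound : K * N * z ≤ W + K * (x * x)
  bound = subst₂ (λ z x → K * N * z ≤ W + K * (x * x))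
                 (sym (sum-empties² A k)) (sym (sum-empties A (suc k)))
                 (empties-variance-bound k m)
  factor-K : ∀ K s₂ N x → K * s₂ * N + K * (x * x) ≡ K * (N * s₂ + x * x)
  factor-K = solve-∀
  swap-last : ∀ W X K s → W + X + K * (s * s) ≡ W + K * s * s + X
  swap-last = solve-∀

pos-*³ : ∀ a b c → + (a * b * c) ≡ + a ℤ.* + b ℤ.* + c
pos-*³ a b c = trans (ℤP.pos-* (a * b) c) (cong (ℤ._* + c) (ℤP.pos-* a b))

variance-fractionᵘ : ∀ s₁ s₂ K m V → K * s₂ * suc m ℕ.< V * suc m * suc m + K * s₁ * s₁ →
  ((+ s₂ ℚᵘ./ suc m) ℚᵘ.- (+ s₁ ℚᵘ./ suc m) ℚᵘ.* (+ s₁ ℚᵘ./ suc m)) ℚᵘ.* (+ K ℚᵘ./ 1) ℚᵘ.< (+ V ℚᵘ./ 1)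
variance-fractionᵘ s₁ s₂ K m V lt = ℚᵘ.*<* (begin-strict
  ((+ s₂ ℤ.* (n ℤ.* n) ℤ.+ ℤ.- (+ s₁ ℤ.* + s₁) ℤ.* n) ℤ.* + K) ℤ.* + 1 ≡⟨ numerator (+ s₁) (+ s₂) (+ K) n ⟩
  (p ℤ.- r) ℤ.* n                                                  <⟨ ℤP.*-monoʳ-<-pos n p-r<q ⟩
  q ℤ.* n                                                          ≡⟨ denominator (+ V) n ⟩
  + V ℤ.* ((n ℤ.* (n ℤ.* n)) ℤ.* + 1)                              ∎)
  where
  open ℤP.≤-Reasoning
  N = suc m
  n = + N
  p = + K ℤ.* + s₂ ℤ.* n
  q = + V ℤ.* n ℤ.* n
  r = + K ℤ.* + s₁ ℤ.* + s₁
  lifted : p ℤ.< q ℤ.+ r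
  lifted = subst₂ ℤ._<_ (pos-*³ K s₂ N)
                        (trans (ℤP.pos-+ (V * N * N) (K * s₁ * s₁)) (cong₂ ℤ._+_ (pos-*³ V N N) (pos-*³ K s₁ s₁)))
                        (+<+ lt)
  p-r<q : p ℤ.- r ℤ.< q
  p-r<q = begin-strict
    p ℤ.- r           <⟨ ℤP.+-monoˡ-< (ℤ.- r) lifted ⟩
    q ℤ.+ r ℤ.- r     ≡⟨ cancel q r ⟩
    q                 ∎
    where
    cancel : ∀ (q r : ℤ) → q ℤ.+ r ℤ.- r ≡ q
    cancel = ℤ-Ring.solve-∀
  numerator : ∀ (s₁ s₂ K n : ℤ) → ((s₂ ℤ.* (n ℤ.* n) ℤ.+ ℤ.- (s₁ ℤ.* s₁) ℤ.* n) ℤ.* K) ℤ.* ℤ.1ℤ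
              ≡ (K ℤ.* s₂ ℤ.* n ℤ.- K ℤ.* s₁ ℤ.* s₁) ℤ.* n
  numerator = ℤ-Ring.solve-∀
  denominator : ∀ (V n : ℤ) → V ℤ.* n ℤ.* n ℤ.* n ≡ V ℤ.* ((n ℤ.* (n ℤ.* n)) ℤ.* ℤ.1ℤ)
  denominator = ℤ-Ring.solve-∀

toℚᵘ-/ : ∀ i m → toℚᵘ (i / suc m) ℚᵘ.≃ (i ℚᵘ./ suc m)
toℚᵘ-/ i m = toℚᵘ-fromℚᵘ (ℚᵘ.mkℚᵘ i m)

variance-fraction : (n : ℕ) .{{_ : ℕ.NonZero n}} (s₁ s₂ K V : ℕ) →
  K * s₂ * n ℕ.< V * n * n + K * s₁ * s₁ →
  ((+ s₂ / n) ℚ.- (+ s₁ / n) ℚ.* (+ s₁ / n)) ℚ.* (+ K / 1) < + V / 1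
variance-fraction (suc m) s₁ s₂ K V lt =
  toℚᵘ-cancel-< (ℚᵘP.<-respʳ-≃ (ℚᵘP.≃-sym (toℚᵘ-/ (+ V) 0))
                (ℚᵘP.<-respˡ-≃ (ℚᵘP.≃-sym image) (variance-fractionᵘ s₁ s₂ K m V lt)))
  where
  e₁ = + s₁ / suc m
  e₂ = + s₂ / suc m
  square : toℚᵘ (e₁ ℚ.* e₁) ℚᵘ.≃ (+ s₁ ℚᵘ./ suc m) ℚᵘ.* (+ s₁ ℚᵘ./ suc m)
  square = ℚᵘP.≃-trans (toℚᵘ-homo-* e₁ e₁) (ℚᵘP.*-cong (toℚᵘ-/ (+ s₁) m) (toℚᵘ-/ (+ s₁) m))
  difference : toℚᵘ (e₂ ℚ.- e₁ ℚ.* e₁) ℚᵘ.≃ (+ s₂ ℚᵘ./ suc m) ℚᵘ.- (+ s₁ ℚᵘ./ suc m) ℚᵘ.* (+ s₁ ℚᵘ./ suc m)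
  difference = ℚᵘP.≃-trans (toℚᵘ-homo-+ e₂ (ℚ.- (e₁ ℚ.* e₁)))
                 (ℚᵘP.+-cong (toℚᵘ-/ (+ s₂) m) (ℚᵘP.≃-trans (toℚᵘ-homo‿- (e₁ ℚ.* e₁)) (ℚᵘP.-‿cong square)))
  image : toℚᵘ ((e₂ ℚ.- e₁ ℚ.* e₁) ℚ.* (+ K / 1))
          ℚᵘ.≃ ((+ s₂ ℚᵘ./ suc m) ℚᵘ.- (+ s₁ ℚᵘ./ suc m) ℚᵘ.* (+ s₁ ℚᵘ./ suc m)) ℚᵘ.* (+ K ℚᵘ./ 1)
  image = ℚᵘP.≃-trans (toℚᵘ-homo-* (e₂ ℚ.- e₁ ℚ.* e₁) (+ K / 1)) (ℚᵘP.*-cong difference (toℚᵘ-/ (+ K) 0))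

mainTheorem17 : (A K : ℕ) → 100 ≤ A → 20 * A ≤ K →
    varNonempty A K ℚ.* ((+ K) / 1) < (+ (4 * (A * A))) / 1
mainTheorem17 zero          K             ()        _
mainTheorem17 (suc zero)    K             (s≤s ())  _
mainTheorem17 (suc (suc m)) zero          _         ()
mainTheorem17 (suc (suc m)) (suc zero)    _         (s≤s ())
mainTheorem17 A@(suc (suc m)) K@(suc (suc k)) _ _ =
  variance-fraction N s₁ s₂ K V
    (≤-<-trans (nonempty-variance-bound k m) (+-monoˡ-< (K * s₁ * s₁) scaled-W<V))
  where
  N s₁ s₂ V : ℕ
  N = K ^ A
  s₁ = sumFun A K nonempty
  s₂ = sumFun A K (λ f → nonempty f * nonempty f)
  V = 4 * (A * A)
  instance
    N≢0 : ℕ.NonZero N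
    N≢0 = m^n≢0 K A
  W<V : A * suc m ℕ.< V
  W<V = ≤-trans (*-monoʳ-< A (n<1+n (suc m))) (m≤n*m (A * A) 4)
  scaled-W<V : A * suc m * N * N ℕ.< V * N * N
  scaled-W<V = *-monoˡ-< N (*-monoˡ-< N W<V)
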